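{- (Consistency.) There is no $\mathbf{KP}$-term $t$ such that $\vdash_{\mathbf{KP}} t:\bot$ (in the empty typing context).
   Context: Formulas are built from propositional atoms and $\bot$ using $\to,\land,\lor$; $\neg B$ abbreviates $B\to\bot$. $\mathbf{KP}$-terms: $t,s,u ::= x \mid t\,s \mid \lambda x.t \mid \mathtt{efq}(t) \mid \langle t,s\rangle \mid \pi_i t \mid \mathtt{in}_i t \mid \mathtt{case}\ t\ [y.s_1]\ [y.s_2] \mid \mathtt{hop}(x.t,\ y.s_1,\ y.s_2)$ ($i\in\{1,2\}$), with $x$ bound in $t$ and $y$ in $s_1,s_2$ in $\mathtt{hop}$. $\Gamma\vdash_{\mathbf{KP}} t:A$ is derived by the standard natural-deduction rules of intuitionistic propositional logic (axiom for declared variables; $\lambda$ for $\to_I$; application for $\to_E$; pairs for $\land_I$; $\pi_i t:A_i$ from $t:A_1\land A_2$; $\mathtt{in}_i t:A_1\lor A_2$ from $t:A_i$; $\mathtt{case}\,t\,[y.s_1][y.s_2]:D$ from $\Gamma\vdash t:A_1\lor A_2$ and $\Gamma,y:A_i\vdash s_i:D$; $\mathtt{efq}(t):A$ from $t:\bot$) plus the Harrop rule: from $\Gamma,x:\neg B\vdash t:A_1\lor A_2$, $\Gamma,y:\neg B\to A_1\vdash s_1:D$, $\Gamma,y:\neg B\to A_2\vdash s_2:D$ infer $\Gamma\vdash\mathtt{hop}(x.t,y.s_1,y.s_2):D$. -}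

module Defs where

open import Data.Nat using (ℕ)
open import Data.List using (List; []; _∷_)
open import Data.Product using (_×_; _,_)
open import Relation.Binary.PropositionalEquality using (_≡_)
open import Relation.Nullary using (¬_)

data Formula : Set where
  atom : ℕ → Formula
  ⊥'   : Formula
  _⇒_  : Formula → Formula → Formula
  _∧_  : Formula → Formula → Formula
  _∨_  : Formula → Formula → Formula

infixr 5 _⇒_

neg : Formula → Formula
neg B = B ⇒ ⊥'

Var : Set
Var = ℕ

data Term : Set where
  var  : Var → Term
  app  : Term → Term → Term
  lam  : Var → Term → Term
  efq  : Term → Term
  pair : Term → Term → Term
  π₁ π₂ : Term → Term
  in₁ in₂ : Term → Term
  case : Term → Var → Term → Var → Term → Term       -- case t [y.s1] [y.s2]
  hop  : Var → Term → Var → Term → Term → Term       -- hop(x.t, y.s1, y.s2)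

-- Typing contexts: lists of declarations, most recent first
-- (a later declaration of a variable shadows earlier ones).
Context : Set
Context = List (Var × Formula)

_,,_∶_ : Context → Var → Formula → Context
Γ ,, x ∶ A = (x , A) ∷ Γ

data _∋_∶_ : Context → Var → Formula → Set where
  here  : ∀ {Γ x A} → ((x , A) ∷ Γ) ∋ x ∶ A
  there : ∀ {Γ x y A B} → ¬ (x ≡ y) → Γ ∋ x ∶ A → ((y , B) ∷ Γ) ∋ x ∶ A

data _⊢_∶_ : Context → Term → Formula → Set where
  ax    : ∀ {Γ x A} → Γ ∋ x ∶ A → Γ ⊢ var x ∶ A
  ⇒I    : ∀ {Γ x t A B} → (Γ ,, x ∶ A) ⊢ t ∶ B → Γ ⊢ lam x t ∶ (A ⇒ B)
  ⇒E    : ∀ {Γ t s A B} → Γ ⊢ t ∶ (A ⇒ B) → Γ ⊢ s ∶ A → Γ ⊢ app t s ∶ B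
  ∧I    : ∀ {Γ t s A B} → Γ ⊢ t ∶ A → Γ ⊢ s ∶ B → Γ ⊢ pair t s ∶ (A ∧ B)
  ∧E₁   : ∀ {Γ t A B} → Γ ⊢ t ∶ (A ∧ B) → Γ ⊢ π₁ t ∶ A
  ∧E₂   : ∀ {Γ t A B} → Γ ⊢ t ∶ (A ∧ B) → Γ ⊢ π₂ t ∶ B
  ∨I₁   : ∀ {Γ t A B} → Γ ⊢ t ∶ A → Γ ⊢ in₁ t ∶ (A ∨ B)
  ∨I₂   : ∀ {Γ t A B} → Γ ⊢ t ∶ B → Γ ⊢ in₂ t ∶ (A ∨ B)
  ∨E    : ∀ {Γ t y s₁ s₂ A₁ A₂ D}
          → Γ ⊢ t ∶ (A₁ ∨ A₂)
          → (Γ ,, y ∶ A₁) ⊢ s₁ ∶ D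
          → (Γ ,, y ∶ A₂) ⊢ s₂ ∶ D
          → Γ ⊢ case t y s₁ y s₂ ∶ D
  ⊥E    : ∀ {Γ t A} → Γ ⊢ t ∶ ⊥' → Γ ⊢ efq t ∶ A
  harrop : ∀ {Γ x t y s₁ s₂ B A₁ A₂ D}
          → (Γ ,, x ∶ neg B) ⊢ t ∶ (A₁ ∨ A₂)
          → (Γ ,, y ∶ (neg B ⇒ A₁)) ⊢ s₁ ∶ D
          → (Γ ,, y ∶ (neg B ⇒ A₂)) ⊢ s₂ ∶ D
          → Γ ⊢ hop x t y s₁ s₂ ∶ D

-- The proof is semantic.  Every formula is evaluated in the two-element
-- Boolean algebra under an arbitrary valuation ρ of the atoms, and a context
-- is satisfied by ρ when all its declared formulas evaluate to true.  The
-- soundness theorem states that every derivable judgement Γ ⊢ t ∶ A is valid: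
-- if ρ satisfies Γ then A is true under ρ.  The Harrop rule
-- is sound because Boolean truth is decidable: either ¬B is true, and the
-- premise yields A₁ or A₂ and hence ¬B → Aᵢ; or ¬B is false, and then ¬B → A₁
-- holds vacuously.  Consistency follows: the empty context is satisfied by any
-- valuation, while ⊥ is false under every valuation.
module Submission where

open import Defs
open import Data.Bool using (Bool; true; false; T; not) renaming (_∨_ to _∨ᵇ_; _∧_ to _∧ᵇ_)
open import Data.Bool.Properties using (T-∧; T-∨; T?)
open import Data.Empty using (⊥-elim)
open import Data.List using ([]; _∷_)
open import Data.List.Relation.Unary.All using (All; []; _∷_)
open import Data.Nat using (ℕ)
open import Data.Product using (∃; _,_; proj₁; proj₂)
open import Data.Sum using (inj₁; inj₂)
open import Function.Bundles using (Equivalence)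
open import Relation.Nullary using (¬_; yes; no)

_⇒ᵇ_ : Bool → Bool → Bool
a ⇒ᵇ b = not a ∨ᵇ b

⇒ᵇ-elim : ∀ a b → T (a ⇒ᵇ b) → T a → T b
⇒ᵇ-elim true  b ab _ = ab

⇒ᵇ-intro : ∀ a b → (T a → T b) → T (a ⇒ᵇ b)
⇒ᵇ-intro true  b f = f _
⇒ᵇ-intro false b f = _

⟦_⟧ : Formula → (ℕ → Bool) → Bool
⟦ atom n ⟧ ρ = ρ n
⟦ ⊥'     ⟧ ρ = false
⟦ A ⇒ B  ⟧ ρ = ⟦ A ⟧ ρ ⇒ᵇ ⟦ B ⟧ ρ
⟦ A ∧ B  ⟧ ρ = ⟦ A ⟧ ρ ∧ᵇ ⟦ B ⟧ ρ
⟦ A ∨ B  ⟧ ρ = ⟦ A ⟧ ρ ∨ᵇ ⟦ B ⟧ ρ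

_⊨_ : (ℕ → Bool) → Context → Set
ρ ⊨ Γ = All (λ { (_ , A) → T (⟦ A ⟧ ρ) }) Γ

lookup-⊨ : ∀ {ρ Γ x A} → Γ ∋ x ∶ A → ρ ⊨ Γ → T (⟦ A ⟧ ρ)
lookup-⊨ here        (a ∷ _) = a
lookup-⊨ (there _ p) (_ ∷ s) = lookup-⊨ p s

sound : ∀ {ρ Γ t A} → Γ ⊢ t ∶ A → ρ ⊨ Γ → T (⟦ A ⟧ ρ)
sound (ax p) s = lookup-⊨ p s
sound {ρ} (⇒I {A = A} {B} d) s =
  ⇒ᵇ-intro (⟦ A ⟧ ρ) (⟦ B ⟧ ρ) λ a → sound d (a ∷ s)
sound {ρ} (⇒E {A = A} {B} d e) s =
  ⇒ᵇ-elim (⟦ A ⟧ ρ) (⟦ B ⟧ ρ) (sound d s) (sound e s)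
sound (∧I d e) s = Equivalence.from T-∧ (sound d s , sound e s)
sound (∧E₁ d) s = proj₁ (Equivalence.to T-∧ (sound d s))
sound (∧E₂ d) s = proj₂ (Equivalence.to T-∧ (sound d s))
sound (∨I₁ d) s = Equivalence.from T-∨ (inj₁ (sound d s))
sound (∨I₂ d) s = Equivalence.from T-∨ (inj₂ (sound d s))
sound (∨E d e f) s with Equivalence.to T-∨ (sound d s)
... | inj₁ a₁ = sound e (a₁ ∷ s)
... | inj₂ a₂ = sound f (a₂ ∷ s)
sound (⊥E d) s = ⊥-elim (sound d s)
sound {ρ} (harrop {B = B} {A₁} {A₂} d e f) s with T? (⟦ neg B ⟧ ρ)
... | no ¬nb = sound e (⇒ᵇ-intro (⟦ neg B ⟧ ρ) (⟦ A₁ ⟧ ρ) (λ nb → ⊥-elim (¬nb nb)) ∷ s)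
... | yes nb with Equivalence.to T-∨ (sound d (nb ∷ s))
...   | inj₁ a₁ = sound e (⇒ᵇ-intro (⟦ neg B ⟧ ρ) (⟦ A₁ ⟧ ρ) (λ _ → a₁) ∷ s)
...   | inj₂ a₂ = sound f (⇒ᵇ-intro (⟦ neg B ⟧ ρ) (⟦ A₂ ⟧ ρ) (λ _ → a₂) ∷ s)

mainTheorem8 : ¬ (∃ λ (t : Term) → [] ⊢ t ∶ ⊥')
mainTheorem8 (_ , d) = sound {ρ = λ _ → false} d []
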